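{- Let $G=(A\cup B,E)$ be an instance of the strongly stable matching problem and let $\mathcal{X}$ be the set of $\sim$-equivalence classes of strongly stable matchings of $G$. The map $S\mapsto\bigvee S$ is a bijection from the set of nonempty closed subsets of $I(\mathcal{M}_G)$ onto $\mathcal{X}$.
   Context: An instance of the strongly stable matching problem is a finite bipartite graph $G=(A\cup B,E)$ (vertices of $A$ are "men", of $B$ "women") in which every vertex $v$ has a preference list: its neighbours are partitioned into disjoint ties (possibly singletons) which are linearly ordered. For neighbours $x,y$ of $v$ write $x\succ_v y$ if $x$ lies in a strictly earlier tie than $y$, $x=_v y$ if in the same tie, $x\succeq_v y$ if either. A matching is a set of pairwise vertex-disjoint edges; $M(v)$ is the partner of $v$. An edge $e\in E\setminus M$ blocks $M$ if its endpoints can be labelled $x,y$ with ($x$ unmatched or $y\succ_x M(x)$) and ($y$ unmatched or $x\succeq_y M(y)$); $M$ is strongly stable if no edge blocks it. All strongly stable matchings match the same vertices. For strongly stable $M,N$: $M\succeq N$ ($M$ dominates $N$) if $M(m)\succeq_m N(m)$ for every matched man $m$; $M\sim N$ if $M(m)=_m N(m)$ for every matched man $m$; $[M]$ is the $\sim$-class of $M$, and $[M]\succeq[N]$ iff $M\succeq N$. The operation $M\vee N$ is the matching containing, for each matched man $m$, the edge $(m,N(m))$ if $M(m)\succ_m N(m)$ and $(m,M(m))$ otherwise; it is strongly stable, and $[M]\vee[N]:=[M\vee N]$ is well defined. For a nonempty finite set $S$ of classes, $\bigvee S$ is the iterated $\vee$ of its elements. For an edge $(a,b)$ ($a\in A$)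 contained in some strongly stable matching, let $N$ be a strongly stable matching containing $(a,b)$ that dominates every strongly stable matching containing $(a,b)$ (such $N$ exists); define $M(a,b):=[N]$. A class is irreducible if it equals $M(a,b)$ for some such edge; $I(\mathcal{M}_G)$ is the set of irreducible classes, partially ordered by dominance. A subset $S\subseteq I(\mathcal{M}_G)$ is closed if whenever $T\in S$ and $T'\in I(\mathcal{M}_G)$ dominates $T$, then $T'\in S$. -}

module Defs where

open import Data.Nat using (ℕ; _≤_; _<_; _<ᵇ_)
open import Data.Fin using (Fin)
open import Data.Bool using (Bool; true; false; if_then_else_)
open import Data.Maybe using (Maybe; just; nothing)
open import Data.Product using (Σ; _×_; _,_; ∃; ∃-syntax)
open import Data.Sum using (_⊎_)
open import Data.List using (List)
open import Data.List.NonEmpty using (List⁺; toList; foldr₁)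
open import Data.List.Membership.Propositional using (_∈_)
open import Relation.Binary.PropositionalEquality using (_≡_; _≢_)
open import Relation.Nullary using (¬_)

-- An instance of the strongly stable matching problem with men A = Fin m
-- and women B = Fin n.  Preference lists
-- with ties are encoded by rank functions: for a man a, the tie containing
-- neighbour b is rkA a b (smaller rank = strictly earlier tie, i.e. better);
-- two neighbours lie in the same tie iff they have the same rank.  Ranks of
-- non-neighbours are irrelevant.  Every partition of the neighbours into
-- linearly ordered ties arises in this way.
record Instance (m n : ℕ) : Set where
  field
    adj : Fin m → Fin n → Bool
    rkA : Fin m → Fin n → ℕ
    rkB : Fin n → Fin m → ℕ

Matching : ℕ → ℕ → Set
Matching m n = Fin m → Maybe (Fin n)

module Inst {m n : ℕ} (G : Instance m n) where
  open Instance G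

  Edge : Fin m → Fin n → Set
  Edge a b = adj a b ≡ true

  IsMatching : Matching m n → Set
  IsMatching M = (∀ a b → M a ≡ just b → Edge a b)
               × (∀ a a' b → M a ≡ just b → M a' ≡ just b → a ≡ a')

  ManStrict : Matching m n → Fin m → Fin n → Set
  ManStrict M a b = ∀ b' → M a ≡ just b' → rkA a b < rkA a b'
  ManWeak : Matching m n → Fin m → Fin n → Set
  ManWeak M a b = ∀ b' → M a ≡ just b' → rkA a b ≤ rkA a b'
  WomanStrict : Matching m n → Fin n → Fin m → Set
  WomanStrict M b a = ∀ a' → M a' ≡ just b → rkB b a < rkB b a'
  WomanWeak : Matching m n → Fin n → Fin m → Set
  WomanWeak M b a = ∀ a' → M a' ≡ just b → rkB b a ≤ rkB b a'

  Blocks : Matching m n → Fin m → Fin n → Set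
  Blocks M a b = Edge a b × M a ≢ just b
               × ((ManStrict M a b × WomanWeak M b a)
                  ⊎ (WomanStrict M b a × ManWeak M a b))

  StronglyStable : Matching m n → Set
  StronglyStable M = IsMatching M × (∀ a b → ¬ Blocks M a b)

  _⪰_ : Matching m n → Matching m n → Set
  M ⪰ N = ∀ a b b' → M a ≡ just b → N a ≡ just b' → rkA a b ≤ rkA a b'

  _∼_ : Matching m n → Matching m n → Set
  M ∼ N = ∀ a b b' → M a ≡ just b → N a ≡ just b' → rkA a b ≡ rkA a b'

  _∨_ : Matching m n → Matching m n → Matching m n
  (M ∨ N) a with M a | N a
  ... | just b | just b' = if rkA a b <ᵇ rkA a b' then just b' else just b
  ... | just b | nothing = just b
  ... | nothing | _ = nothing
  -- (the last two cases never occur for strongly stable M, N)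

  ⋁ : List⁺ (Matching m n) → Matching m n
  ⋁ L = foldr₁ _∨_ L

  -- The class [P] is irreducible: [P] = M(a,b) for some edge (a,b) lying in
  -- some strongly stable matching, where N is a strongly stable matching
  -- containing (a,b) that dominates every strongly stable matching
  -- containing (a,b).
  Irreducible : Matching m n → Set
  Irreducible P = ∃[ a ] ∃[ b ] ∃[ N ]
      ( StronglyStable N × N a ≡ just b
      × (∀ N' → StronglyStable N' → N' a ≡ just b → N ⪰ N')
      × N ∼ P )

  -- A nonempty finite set S of classes is represented by a nonempty list of
  -- representatives.  'Admissible L': S is a nonempty closed subset of
  -- I(M_G).
  Admissible : List⁺ (Matching m n) → Set
  Admissible L =
      (∀ {T} → T ∈ toList L → StronglyStable T × Irreducible T)
    × (∀ {T} → T ∈ toList L → ∀ T' → StronglyStable T' → Irreducible T'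
         → T' ⪰ T → ∃[ T'' ] (T'' ∈ toList L × T'' ∼ T'))

  SameClasses : List⁺ (Matching m n) → List⁺ (Matching m n) → Set
  SameClasses L₁ L₂ =
      (∀ {T} → T ∈ toList L₁ → ∃[ T' ] (T' ∈ toList L₂ × T ∼ T'))
    × (∀ {T} → T ∈ toList L₂ → ∃[ T' ] (T' ∈ toList L₁ × T ∼ T'))

module Submission where

-- The engine is an alternating-chain argument ('Chain'): if M, N are strongly
-- stable and x strictly prefers b = M(x) to N(x), then b is N-matched to a man
-- she strictly prefers to x, who again strictly prefers M to N.  This step is
-- injective on a finite set, hence onto ('injective⇒onto'); so strongly
-- stable matchings match the same men.  With it, and the fact that a pair
-- blocking J blocks X if both are no worse off in J ('blockTransfer'), the
-- pointwise worse choice M ∨ N and better choice M ∧ N are strongly stable.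
--
-- Hence ⋁ L is strongly stable, dominated by each member of L, and gives each
-- man his partner in some member: S ↦ ⋁ S is well defined.  It is injective
-- since M(a,b) dominates every T with T(a) no better than b ('best⪰'), and
-- onto since M(a,b) is computable as the meet of all strongly stable
-- matchings containing (a,b) (enumerating matchings) and the classes M(a,b)
-- dominating a strongly stable M form a closed set joining to M ('⋁-onto').

open import Defs
open import Data.Nat using (ℕ)
open import Data.Product using (_×_; ∃-syntax)

open import Data.Nat using (zero; suc; _+_; _≤_; _<_; _≥_; _>_; _<ᵇ_; _≤?_; _<?_)
open import Data.Nat.Properties
open import Data.Fin as Fin using (Fin; toℕ)
import Data.Fin.Properties as Fin
open import Data.Bool using (true; false; if_then_else_) renaming (T to IsTrue)
import Data.Bool.Properties as Bool
open import Data.Maybe using (Maybe; just; nothing)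
open import Data.Maybe.Properties using (just-injective)
import Data.Maybe.Properties as Maybe
open import Data.Product using (_,_; proj₁; proj₂; ∃)
open import Data.Sum using (_⊎_; inj₁; inj₂)
open import Data.Empty using (⊥; ⊥-elim)
open import Data.Unit using (tt)
open import Data.List using (List; []; _∷_; map; allFin; filter; concatMap; cartesianProduct; cartesianProductWith)
open import Data.List.NonEmpty using (List⁺; toList) renaming (_∷_ to _∷⁺_)
open import Data.List.Membership.Propositional using (_∈_; lose)
open import Data.List.Membership.Propositional.Properties
  using (∈-map⁺; ∈-allFin; ∈-filter⁺; ∈-filter⁻; ∈-concatMap⁺; ∈-concatMap⁻;
         ∈-cartesianProduct⁺; ∈-cartesianProductWith⁺)
open import Data.List.Relation.Unary.Any using (here; there; satisfied)
import Data.Vec.Functional as Vector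
open import Relation.Nullary using (¬_; Dec; yes; no)
open import Relation.Nullary.Decidable using (_×-dec_; _⊎-dec_; _→-dec_; ¬?)
open import Relation.Binary.PropositionalEquality hiding (J)

-- An endomap of a subset of Fin k that is injective on underlying elements is
-- onto: the orbit of x repeats by the pigeonhole principle, and injectivity
-- cancels the common prefix of the repetition, which puts x in the image.
module _ {k : ℕ} {P : Fin k → Set} (f : ∃ P → ∃ P)
         (injective : ∀ x y → proj₁ (f x) ≡ proj₁ (f y) → proj₁ x ≡ proj₁ y) where
  private
    iterate : ℕ → ∃ P → ∃ P
    iterate zero    x = x
    iterate (suc i) x = f (iterate i x)

    cancel : ∀ i d x → proj₁ (iterate i x) ≡ proj₁ (iterate (i + d) x)
           → proj₁ x ≡ proj₁ (iterate d x)
    cancel zero    d x e = e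
    cancel (suc i) d x e = cancel i d x (injective _ _ e)

  injective⇒onto : ∀ x → ∃[ y ] (proj₁ (f y) ≡ proj₁ x)
  injective⇒onto x with Fin.pigeonhole (n<1+n k) (λ i → proj₁ (iterate (toℕ i) x))
  ... | i , j , i<j , repeat with m≤n⇒∃[o]m+o≡n i<j
  ... | d , i+1+d≡j =
    iterate d x , sym (cancel (toℕ i) (suc d) x (subst (λ l → _ ≡ proj₁ (iterate l x)) j≡i+1+d repeat))
    where
      j≡i+1+d : toℕ j ≡ toℕ i + suc d
      j≡i+1+d = sym (trans (+-suc (toℕ i) d) i+1+d≡j)

-- Given a list enumerating A, the functions Fin k → A are enumerated up to
-- pointwise equality (there is no function extensionality).
module Enumeration {A : Set} (xs : List A) (complete : ∀ x → x ∈ xs) where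
  functions : (k : ℕ) → List (Fin k → A)
  functions zero    = Vector.[] ∷ []
  functions (suc k) = cartesianProductWith Vector._∷_ xs (functions k)

  functions-complete : ∀ k (f : Fin k → A) → ∃[ g ] (g ∈ functions k × (∀ i → f i ≡ g i))
  functions-complete zero    f = Vector.[] , here refl , λ ()
  functions-complete (suc k) f with functions-complete k (λ i → f (Fin.suc i))
  ... | g , g∈ , f≗g = f Fin.zero Vector.∷ g , ∈-cartesianProductWith⁺ Vector._∷_ (complete _) g∈ ,
                       λ { Fin.zero → refl ; (Fin.suc i) → f≗g i }

module Properties {m n : ℕ} (G : Instance m n) where
  open Instance G
  open Inst G

  private variable
    M N X J T T' P : Matching m n
    a a' c x : Fin m
    b b' : Fin n

  _≟M_ : (u v : Maybe (Fin n)) → Dec (u ≡ v)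
  _≟M_ = Maybe.≡-dec Fin._≟_

  nothing≢just : nothing ≢ just b
  nothing≢just ()

  samePartner : {u : Maybe (Fin n)} → u ≡ just b → u ≡ just b' → b ≡ b'
  samePartner e e' = just-injective (trans (sym e) e')

  isEdge : StronglyStable M → M a ≡ just b → Edge a b
  isEdge s = proj₁ (proj₁ s) _ _

  womanInjective : StronglyStable M → M a ≡ just b → M a' ≡ just b → a ≡ a'
  womanInjective s = proj₂ (proj₁ s) _ _ _

  unblocked : StronglyStable M → ¬ Blocks M a b
  unblocked s = proj₂ s _ _

  ¬WomanWeak⇒better : (M : Matching m n) → ¬ WomanWeak M b a → ∃[ a' ] (M a' ≡ just b × rkB b a' < rkB b a)
  ¬WomanWeak⇒better {b = b} {a = a} M ¬weak
    with Fin.¬∀⟶∃¬ m _ (λ a' → (M a' ≟M just b) →-dec (rkB b a ≤? rkB b a')) ¬weak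
  ... | a' , ¬p with M a' ≟M just b
  ... | yes e  = a' , e , ≰⇒> (λ le → ¬p (λ _ → le))
  ... | no ¬e = ⊥-elim (¬p (λ e → ⊥-elim (¬e e)))

  ¬WomanStrict⇒notWorse : (M : Matching m n) → ¬ WomanStrict M b a → ∃[ a' ] (M a' ≡ just b × rkB b a' ≤ rkB b a)
  ¬WomanStrict⇒notWorse {b = b} {a = a} M ¬strict
    with Fin.¬∀⟶∃¬ m _ (λ a' → (M a' ≟M just b) →-dec (rkB b a <? rkB b a')) ¬strict
  ... | a' , ¬p with M a' ≟M just b
  ... | yes e  = a' , e , ≮⇒≥ (λ lt → ¬p (λ _ → lt))
  ... | no ¬e = ⊥-elim (¬p (λ e → ⊥-elim (¬e e)))

  ¬ManWeak⇒better : (M : Matching m n) → ¬ ManWeak M a b → ∃[ b' ] (M a ≡ just b' × rkA a b' < rkA a b)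
  ¬ManWeak⇒better {a = a} {b = b} M ¬weak with M a
  ... | nothing = ⊥-elim (¬weak (λ _ ()))
  ... | just c  = c , refl , ≰⇒> (λ le → ¬weak (λ _ e → subst (λ z → rkA a b ≤ rkA a z) (just-injective e) le))

  ManNoWorse : Matching m n → Matching m n → Fin m → Set
  ManNoWorse J X a = ∀ {b'} → X a ≡ just b' → ∃[ c ] (J a ≡ just c × rkA a c ≤ rkA a b')

  WomanNoWorse : Matching m n → Matching m n → Fin n → Set
  WomanNoWorse J X b = ∀ {c} → X c ≡ just b → ∃[ e ] (J e ≡ just b × rkB b e ≤ rkB b c)

  -- A pair blocking J also blocks X when both of its members are at least as
  -- well off in J as in X.  This is how stability passes to ∨ and ∧.
  blockTransfer : Blocks J a b → ManNoWorse J X a → WomanNoWorse J X b → Blocks X a b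
  blockTransfer {J} {a} {b} {X} (edge , a≁b , kind) man woman = edge , notInX kind , transfer kind
    where
      notInX : (ManStrict J a b × WomanWeak J b a) ⊎ (WomanStrict J b a × ManWeak J a b)
             → X a ≢ just b
      notInX (inj₁ (strict , _)) xa with man xa
      ... | c , ja , c≤b = <-irrefl refl (<-≤-trans (strict c ja) c≤b)
      notInX (inj₂ (strict , _)) xa with woman xa
      ... | e , je , e≤a = <-irrefl refl (<-≤-trans (strict e je) e≤a)

      transfer : (ManStrict J a b × WomanWeak J b a) ⊎ (WomanStrict J b a × ManWeak J a b)
               → (ManStrict X a b × WomanWeak X b a) ⊎ (WomanStrict X b a × ManWeak X a b)
      transfer (inj₁ (strict , weak)) =
        inj₁ ( (λ b' xa → let (c , ja , c≤b') = man xa in <-≤-trans (strict c ja) c≤b')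
             , (λ c xc → let (e , je , e≤c) = woman xc in ≤-trans (weak e je) e≤c) )
      transfer (inj₂ (strict , weak)) =
        inj₂ ( (λ c xc → let (e , je , e≤c) = woman xc in <-≤-trans (strict e je) e≤c)
             , (λ b' xa → let (c , ja , c≤b') = man xa in ≤-trans (weak c ja) c≤b') )

  sameMan : (∀ {b'} → X a ≡ just b' → J a ≡ just b') → ManNoWorse J X a
  sameMan same xa = _ , same xa , ≤-refl

  sameWoman : (∀ {c} → X c ≡ just b → J c ≡ just b) → WomanNoWorse J X b
  sameWoman same xc = _ , same xc , ≤-refl

  PrefersFirst : Matching m n → Matching m n → Fin m → Set
  PrefersFirst M N x = ∃[ b ] (M x ≡ just b × ManStrict N x b)

  module Chain {M N : Matching m n} (sM : StronglyStable M) (sN : StronglyStable N) where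
    -- If x prefers b = M(x), then (x,b) does not block N only because b has an
    -- N-partner x' whom she strictly prefers to x; and (x',b) does not block M
    -- only because x' strictly prefers his M-partner to b.
    next : M x ≡ just b → ManStrict N x b
         → ∃[ x' ] (PrefersFirst M N x' × N x' ≡ just b × rkB b x' < rkB b x)
    next {x} {b} mx strict =
      let (x' , nx' , x'<x) = ¬WomanWeak⇒better N (λ weak →
                                unblocked sN (isEdge sM mx , nx≢b , inj₁ (strict , weak)))
          mx'≢b : M x' ≢ just b
          mx'≢b e = nx≢b (subst (λ z → N z ≡ just b) (womanInjective sM e mx) nx')
          herChoice : WomanStrict M b x'
          herChoice _ ma = subst (λ z → rkB b x' < rkB b z) (womanInjective sM mx ma) x'<x
          (b'' , mx' , b''<b) = ¬ManWeak⇒better M (λ weak →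
                                  unblocked sM (isEdge sN nx' , mx'≢b , inj₂ (herChoice , weak)))
      in x' , (b'' , mx' , λ _ nx'' → subst (λ z → rkA x' b'' < rkA x' z) (samePartner nx' nx'') b''<b)
            , nx' , x'<x
      where
        nx≢b : N x ≢ just b
        nx≢b e = <-irrefl refl (strict b e)

    -- The chain step on the set of men preferring M; it is injective since
    -- the next man determines the woman M(x), which determines x.
    step : ∃ (PrefersFirst M N) → ∃ (PrefersFirst M N)
    step (x , b , mx , strict) = let (x' , pref , _) = next mx strict in x' , pref

    stepTakes : (mx : M x ≡ just b) (strict : ManStrict N x b) → N (proj₁ (next mx strict)) ≡ just b
    stepTakes mx strict = proj₁ (proj₂ (proj₂ (next mx strict)))

    step-injective : ∀ x y → proj₁ (step x) ≡ proj₁ (step y) → proj₁ x ≡ proj₁ y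
    step-injective (x , b , mx , sx) (y , b' , my , sy) x'≡y'
      with samePartner (stepTakes mx sx) (trans (cong N x'≡y') (stepTakes my sy))
    ... | refl = womanInjective sM mx my

    -- Since the step is onto, the N-partner of a man preferring M is the
    -- M-partner of another man preferring M.
    previous : PrefersFirst M N x → ∃[ z ] (PrefersFirst M N z × ∃[ b ] (M z ≡ just b × N x ≡ just b))
    previous {x} pref with injective⇒onto step step-injective (x , pref)
    ... | (z , b , mz , sz) , z'≡x =
      z , (b , mz , sz) , b , mz , subst (λ w → N w ≡ just b) z'≡x (stepTakes mz sz)

    -- Every man matched in M is matched in N: otherwise he prefers M, and
    -- 'previous' gives him an N-partner.
    matched : M a ≡ just b → ∃[ b' ] N a ≡ just b'
    matched {a} {b} ma with N a in na
    ... | just b' = b' , refl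
    ... | nothing with previous (b , ma , λ _ e → ⊥-elim (nothing≢just (trans (sym na) e)))
    ...   | _ , _ , _ , _ , e = ⊥-elim (nothing≢just (trans (sym na) e))

  matchedIn : StronglyStable M → StronglyStable N → M a ≡ just b → ∃[ b' ] N a ≡ just b'
  matchedIn sM sN = Chain.matched sM sN

  -- Choice a _≺_ _≽_ u v w: the man a, whose partners in two matchings are u
  -- and v, gets w; he switches to v exactly when both exist and u ≺ v in rank,
  -- and otherwise keeps u, in which case the complementary u ≽ v holds.
  data Choice (a : Fin m) (_≺_ _≽_ : ℕ → ℕ → Set) (u v w : Maybe (Fin n)) : Set where
    keepFirst    : w ≡ u → (∀ {b b'} → u ≡ just b → v ≡ just b' → rkA a b ≽ rkA a b')
                 → Choice a _≺_ _≽_ u v w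
    switchSecond : ∀ {b b'} → u ≡ just b → v ≡ just b' → rkA a b ≺ rkA a b' → w ≡ just b'
                 → Choice a _≺_ _≽_ u v w

  joinView : ∀ M N a → Choice a _<_ _≥_ (M a) (N a) ((M ∨ N) a)
  joinView M N a with M a | N a
  ... | nothing | _       = keepFirst refl (λ ())
  ... | just b  | nothing = keepFirst refl (λ _ ())
  ... | just b  | just b' with rkA a b <ᵇ rkA a b' in b<ᵇb'
  ...   | true  = switchSecond refl refl (<ᵇ⇒< _ _ (subst IsTrue (sym b<ᵇb') tt)) refl
  ...   | false = keepFirst refl (λ { refl refl → ≮⇒≥ (λ lt → subst IsTrue b<ᵇb' (<⇒<ᵇ lt)) })

  _∧_ : Matching m n → Matching m n → Matching m n
  (M ∧ N) a with M a | N a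
  ... | just b  | just b' = if rkA a b' <ᵇ rkA a b then just b' else just b
  ... | just b  | nothing = just b
  ... | nothing | _       = nothing

  meetView : ∀ M N a → Choice a _>_ _≤_ (M a) (N a) ((M ∧ N) a)
  meetView M N a with M a | N a
  ... | nothing | _       = keepFirst refl (λ ())
  ... | just b  | nothing = keepFirst refl (λ _ ())
  ... | just b  | just b' with rkA a b' <ᵇ rkA a b in b'<ᵇb
  ...   | true  = switchSecond refl refl (<ᵇ⇒< _ _ (subst IsTrue (sym b'<ᵇb) tt)) refl
  ...   | false = keepFirst refl (λ { refl refl → ≮⇒≥ (λ lt → subst IsTrue b'<ᵇb (<⇒<ᵇ lt)) })

  choiceFrom : ∀ {R S u v w} → Choice a R S u v w → w ≡ just b → u ≡ just b ⊎ v ≡ just b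
  choiceFrom (keepFirst w≡u _)          e = inj₁ (trans (sym w≡u) e)
  choiceFrom (switchSecond _ v≡b' _ w≡b') e = inj₂ (trans v≡b' (cong just (samePartner w≡b' e)))

  better⇒strict : (N : Matching m n) → N a ≡ just b' → rkA a b < rkA a b' → ManStrict N a b
  better⇒strict _ na lt _ na' = subst (λ z → _ < rkA _ z) (samePartner na na') lt

  ⪰join₁ : ∀ M N → M ⪰ (M ∨ N)
  ⪰join₁ M N a b b' ma ja with joinView M N a
  ... | keepFirst jm _ with samePartner ma (trans (sym jm) ja)
  ...   | refl = ≤-refl
  ⪰join₁ M N a b b' ma ja | switchSecond ma' _ lt jb with samePartner ma' ma | samePartner jb ja
  ...   | refl | refl = <⇒≤ lt

  ⪰join₂ : ∀ M N → N ⪰ (M ∨ N)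
  ⪰join₂ M N a b b' na ja with joinView M N a
  ... | keepFirst jm kept = kept (trans (sym jm) ja) na
  ... | switchSecond _ na' _ jb with samePartner na' na | samePartner jb ja
  ...   | refl | refl = ≤-refl

  meet⪰₁ : ∀ M N → (M ∧ N) ⪰ M
  meet⪰₁ M N a b b' ka ma with meetView M N a
  ... | keepFirst km _ with samePartner ma (trans (sym km) ka)
  ...   | refl = ≤-refl
  meet⪰₁ M N a b b' ka ma | switchSecond ma' _ lt kb with samePartner ma' ma | samePartner kb ka
  ...   | refl | refl = <⇒≤ lt

  meet⪰₂ : ∀ M N → (M ∧ N) ⪰ N
  meet⪰₂ M N a b b' ka na with meetView M N a
  ... | keepFirst km kept = kept (trans (sym km) ka) na
  ... | switchSecond _ na' _ kb with samePartner na' na | samePartner kb ka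
  ...   | refl | refl = ≤-refl

  meetKeeps : (M N : Matching m n) → M a ≡ just b → N a ≡ just b' → rkA a b ≤ rkA a b'
            → (M ∧ N) a ≡ just b
  meetKeeps {a = a} M N ma na le with meetView M N a
  ... | keepFirst km _ = trans km ma
  ... | switchSecond ma' na' lt _ with samePartner ma' ma | samePartner na' na
  ...   | refl | refl = ⊥-elim (<⇒≱ lt le)

  meetMatched : (M N : Matching m n) → M a ≡ just b → ∃[ c ] (M ∧ N) a ≡ just c
  meetMatched {a = a} M N ma with meetView M N a
  ... | keepFirst km _            = _ , trans km ma
  ... | switchSecond _ _ _ kb = _ , kb

  module _ {R S : ℕ → ℕ → Set} (sM : StronglyStable M) (sN : StronglyStable N)
           (view : ∀ a → Choice a R S (M a) (N a) (J a)) where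
    choiceEdge : J a ≡ just b → Edge a b
    choiceEdge {a} ja with choiceFrom (view a) ja
    ... | inj₁ ma = isEdge sM ma
    ... | inj₂ na = isEdge sN na

    choiceInjective
      : (∀ {a a' b c} → (∀ {b₁ b₂} → M a ≡ just b₁ → N a ≡ just b₂ → S (rkA a b₁) (rkA a b₂))
           → M a ≡ just b → M a' ≡ just c → N a' ≡ just b → R (rkA a' c) (rkA a' b) → ⊥)
      → J a ≡ just b → J a' ≡ just b → a ≡ a'
    choiceInjective {a} {b} {a'} collision ja ja' with view a | view a'
    ... | keepFirst jm _ | keepFirst jm' _ = womanInjective sM (trans (sym jm) ja) (trans (sym jm') ja')
    ... | switchSecond _ na _ jb | switchSecond _ na' _ jb' =
      womanInjective sN (trans na (cong just (samePartner jb ja))) (trans na' (cong just (samePartner jb' ja')))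
    ... | keepFirst jm kept | switchSecond mc na' r jb' with samePartner jb' ja'
    ...   | refl = ⊥-elim (collision kept (trans (sym jm) ja) mc na' r)
    choiceInjective {a} {b} {a'} collision ja ja' | switchSecond mc na r jb | keepFirst jm' kept
      with samePartner jb ja
    ...   | refl = ⊥-elim (collision kept (trans (sym jm') ja') mc na r)

  module JoinStable {M N : Matching m n} (sM : StronglyStable M) (sN : StronglyStable N) where
    open Chain sM sN using (next; previous; matched)

    takesN : PrefersFirst M N x → N x ≡ just b → (M ∨ N) x ≡ just b
    takesN {x} (c , mc , strict) nb with joinView M N x
    ... | keepFirst _ kept = ⊥-elim (<⇒≱ (strict _ nb) (kept mc nb))
    ... | switchSecond _ nb' _ jb' = trans jb' (cong just (samePartner nb' nb))

    -- Women are at least as well off in M ∨ N as in M: if c switches away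
    -- from b = M(c), the chain step hands b to a man she prefers to c.
    womenM : WomanNoWorse (M ∨ N) M b
    womenM {b} {c} mc with joinView M N c
    ... | keepFirst jm _ = c , trans jm mc , ≤-refl
    ... | switchSecond mc' nc lt _ with samePartner mc' mc
    ...   | refl = let (x' , pref , nx' , x'<c) = next mc (better⇒strict N nc lt)
                   in x' , takesN pref nx' , <⇒≤ x'<c

    -- Women are at least as well off in M ∨ N as in N: if d keeps M(d), he
    -- weakly prefers b = N(d) to it, so unless M(d) = b, the pair (d,b) fails
    -- to block M only because b has an M-partner she likes at least as much.
    womenN : WomanNoWorse (M ∨ N) N b
    womenN {b} {d} nd with joinView M N d
    ... | switchSecond _ nd' _ jd = d , trans jd (cong just (samePartner nd' nd)) , ≤-refl
    ... | keepFirst _ kept with M d ≟M just b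
    ...   | yes md    = womenM md
    ...   | no md≢b =
      let (c , mc , c≤d) = ¬WomanStrict⇒notWorse M (λ strict →
                             unblocked sM (isEdge sN nd , md≢b , inj₂ (strict , λ _ md → kept md nd)))
          (e , je , e≤c) = womenM mc
      in e , je , ≤-trans e≤c c≤d

    -- A keeper a with M(a) = b and a switcher a' with N(a') = b cannot
    -- coexist: going back along the chain from a', b is the M-partner of a
    -- man strictly preferring M, who must be a; but a weakly prefers N.
    keeperMeetsSwitcher
      : (∀ {b₁ b₂} → M a ≡ just b₁ → N a ≡ just b₂ → rkA a b₁ ≥ rkA a b₂)
      → M a ≡ just b → M a' ≡ just b' → N a' ≡ just b → rkA a' b' < rkA a' b → ⊥
    keeperMeetsSwitcher kept ma mc na' lt with previous (_ , mc , better⇒strict N na' lt)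
    ... | z , (b₀ , mz , strict) , _ , mz' , na'' with samePartner na'' na'
    ...   | refl with womanInjective sM mz' ma
    ...     | refl with samePartner mz mz' | matched ma
    ...       | refl | d , nd = <⇒≱ (strict d nd) (kept ma nd)

    joinStable : StronglyStable (M ∨ N)
    joinStable = ( (λ _ _ → choiceEdge sM sN (joinView M N))
                 , (λ _ _ _ → choiceInjective sM sN (joinView M N) keeperMeetsSwitcher) )
               , noBlock
      where
        -- A pair blocking M ∨ N would block M (if a keeps M(a)) or N.
        noBlock : ∀ a b → ¬ Blocks (M ∨ N) a b
        noBlock a b blocking with joinView M N a
        ... | keepFirst jm _ = unblocked sM (blockTransfer blocking (sameMan {X = M} {J = M ∨ N} (trans jm)) womenM)
        ... | switchSecond _ na _ ja =
          unblocked sN (blockTransfer blocking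
                          (sameMan {X = N} {J = M ∨ N} (λ na' → trans ja (cong just (samePartner na na'))))
                          womenN)

  module MeetStable {M N : Matching m n} (sM : StronglyStable M) (sN : StronglyStable N) where
    open Chain sN sM using (next; previous; matched)

    K : Matching m n
    K = M ∧ N

    takesN : PrefersFirst N M x → N x ≡ just b → K x ≡ just b
    takesN {x} (c , nc , strict) nb with meetView M N x
    ... | switchSecond _ nb' _ kb' = trans kb' (cong just (samePartner nb' nb))
    ... | keepFirst _ kept with samePartner nc nb | matched nb
    ...   | refl | b₀ , mb₀ = ⊥-elim (<⇒≱ (strict b₀ mb₀) (kept mb₀ nb))

    -- Every woman matched in M is matched in M ∧ N: if c switches away from
    -- b = M(c), going back along the chain of men preferring N shows that b
    -- is the N-partner of a man preferring N, who takes her.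
    covers : M c ≡ just b → ∃[ e ] K e ≡ just b
    covers {c} mc with meetView M N c
    ... | keepFirst km _ = c , trans km mc
    ... | switchSecond mc' nc lt _ with previous (_ , nc , better⇒strict M mc' lt)
    ...   | z , pref , _ , nz , mc'' with samePartner mc'' mc
    ...     | refl = z , takesN pref nz

    -- A keeper a with M(a) = b and a switcher a' with N(a') = b cannot
    -- coexist: the chain step from a' hands b to an M-partner strictly
    -- preferring N, who must be a; but a weakly prefers M.
    keeperMeetsSwitcher
      : (∀ {b₁ b₂} → M a ≡ just b₁ → N a ≡ just b₂ → rkA a b₁ ≤ rkA a b₂)
      → M a ≡ just b → M a' ≡ just b' → N a' ≡ just b → rkA a' b' > rkA a' b → ⊥
    keeperMeetsSwitcher kept ma mc na' gt with next na' (better⇒strict M mc gt)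
    ... | x , (d , nx , strict) , mx , _ with womanInjective sM mx ma
    ...   | refl = <⇒≱ (strict _ ma) (kept ma nx)

    menM : ManNoWorse K M a
    menM {a} ma = let (c , ka) = meetMatched M N ma in c , ka , meet⪰₁ M N a c _ ka ma

    menN : ManNoWorse K N a
    menN {a} na = let (c , ka) = meetMatched M N (proj₂ (matched na))
                  in c , ka , meet⪰₂ M N a c _ ka na

    meetStable : StronglyStable K
    meetStable = ( (λ _ _ → choiceEdge sM sN (meetView M N))
                 , (λ _ _ _ → choiceInjective sM sN (meetView M N) keeperMeetsSwitcher) )
               , noBlock
      where
        -- Woman b keeps in M ∧ N her partner from M or from N (from M if she
        -- were unmatched, which 'covers' excludes), so a pair blocking M ∧ N
        -- would block M or N.
        noBlock : ∀ a b → ¬ Blocks K a b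
        noBlock a b blocking with Fin.any? (λ e → K e ≟M just b)
        ... | no unmatched =
          unblocked sM (blockTransfer blocking menM (λ mc → ⊥-elim (unmatched (covers mc))))
        ... | yes (e , ke) with choiceFrom (meetView M N e) ke
        ...   | inj₁ me = unblocked sM (blockTransfer blocking menM
                            (sameWoman {X = M} {J = K} (λ mc → subst (λ z → K z ≡ just b) (womanInjective sM me mc) ke)))
        ...   | inj₂ ne = unblocked sN (blockTransfer blocking menN
                            (sameWoman {X = N} {J = K} (λ nc → subst (λ z → K z ≡ just b) (womanInjective sN ne nc) ke)))

  -- Dominance is a preorder on strongly stable matchings and ∼ the induced
  -- equivalence; transitivity uses that the middle matching matches the same men.
  ⪰-refl : M ⪰ M
  ⪰-refl _ _ _ e e' = ≤-reflexive (cong (rkA _) (samePartner e e'))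

  ⪰-trans : StronglyStable M → StronglyStable N → M ⪰ N → N ⪰ X → M ⪰ X
  ⪰-trans sM sN M⪰N N⪰X a b b' ma xa =
    let (c , na) = matchedIn sM sN ma in ≤-trans (M⪰N a b c ma na) (N⪰X a c b' na xa)

  ⪰-antisym : M ⪰ N → N ⪰ M → M ∼ N
  ⪰-antisym M⪰N N⪰M a b b' ma na = ≤-antisym (M⪰N a b b' ma na) (N⪰M a b' b na ma)

  ∼⇒⪰ : M ∼ N → M ⪰ N
  ∼⇒⪰ M∼N a b b' ma na = ≤-reflexive (M∼N a b b' ma na)

  ∼-refl : M ∼ M
  ∼-refl _ _ _ e e' = cong (rkA _) (samePartner e e')

  ∼-sym : M ∼ N → N ∼ M
  ∼-sym M∼N a b b' na ma = sym (M∼N a b' b ma na)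

  ∼-trans : StronglyStable M → StronglyStable N → M ∼ N → N ∼ X → M ∼ X
  ∼-trans sM sN M∼N N∼X a b b' ma xa =
    let (c , na) = matchedIn sM sN ma in trans (M∼N a b c ma na) (N∼X a c b' na xa)

  AllStable : List⁺ (Matching m n) → Set
  AllStable L = ∀ {T} → T ∈ toList L → StronglyStable T

  ⋁-stable : ∀ L → AllStable L → StronglyStable (⋁ L)
  ⋁-stable (x ∷⁺ xs) = go x xs
    where
      go : ∀ x xs → AllStable (x ∷⁺ xs) → StronglyStable (⋁ (x ∷⁺ xs))
      go x []       st = st (here refl)
      go x (y ∷ ys) st = JoinStable.joinStable (st (here refl)) (go y ys (λ p → st (there p)))

  ⋁-lower : ∀ L → AllStable L → T ∈ toList L → T ⪰ ⋁ L
  ⋁-lower (x ∷⁺ xs) = go x xs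
    where
      go : ∀ x xs → AllStable (x ∷⁺ xs) → T ∈ toList (x ∷⁺ xs) → T ⪰ ⋁ (x ∷⁺ xs)
      go x []       st (here refl) = ⪰-refl
      go x (y ∷ ys) st (here refl) = ⪰join₁ x (⋁ (y ∷⁺ ys))
      go x (y ∷ ys) st (there p)   =
        ⪰-trans (st (there p)) (⋁-stable (y ∷⁺ ys) (λ q → st (there q)))
                (go y ys (λ q → st (there q)) p) (⪰join₂ x (⋁ (y ∷⁺ ys)))

  ⋁-partner : ∀ L → ⋁ L a ≡ just b → ∃[ T ] (T ∈ toList L × T a ≡ just b)
  ⋁-partner (x ∷⁺ xs) = go x xs
    where
      go : ∀ x xs → ⋁ (x ∷⁺ xs) a ≡ just b → ∃[ T ] (T ∈ toList (x ∷⁺ xs) × T a ≡ just b)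
      go x []       e = x , here refl , e
      go x (y ∷ ys) e with choiceFrom (joinView x (⋁ (y ∷⁺ ys)) _) e
      ... | inj₁ xa = x , here refl , xa
      ... | inj₂ ja = let (T , p , ta) = go y ys ja in T , there p , ta

  ⋁-bound : ∀ L → (∀ {T} → T ∈ toList L → T ⪰ M) → ⋁ L ⪰ M
  ⋁-bound L upper a b b' ja ma = let (T , p , ta) = ⋁-partner L ja in upper p a b b' ta ma

  ⋁-mono : ∀ L₁ L₂ → AllStable L₁ → AllStable L₂
         → (∀ {T} → T ∈ toList L₁ → ∃[ T' ] (T' ∈ toList L₂ × T ∼ T'))
         → ⋁ L₁ ⪰ ⋁ L₂
  ⋁-mono L₁ L₂ st₁ st₂ covered a b b' j₁a j₂a =
    let (T₁ , p₁ , t₁a) = ⋁-partner L₁ j₁a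
        (T₂ , p₂ , T₁∼T₂) = covered p₁
        (c , t₂a) = matchedIn (st₁ p₁) (st₂ p₂) t₁a
    in ≤-trans (≤-reflexive (T₁∼T₂ a b c t₁a t₂a)) (⋁-lower L₂ st₂ p₂ a c b' t₂a j₂a)

  Best : Fin m → Fin n → Matching m n → Set
  Best a b T = StronglyStable T × T a ≡ just b × (∀ N → StronglyStable N → N a ≡ just b → T ⪰ N)

  best⇒irreducible : Best a b T → Irreducible T
  best⇒irreducible {a} {b} {T} (sT , ta , dom) = a , b , T , sT , ta , dom , ∼-refl

  best-unique : Best a b T → Best a b T' → T ∼ T'
  best-unique (sT , ta , domT) (sT' , t'a , domT') = ⪰-antisym (domT _ sT' t'a) (domT' _ sT ta)

  -- M(a,b) dominates every strongly stable T in which a's partner is no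
  -- better than b, because M(a,b) ∧ T still contains (a,b).
  best⪰ : Best a b N → StronglyStable T → T a ≡ just b' → rkA a b ≤ rkA a b' → N ⪰ T
  best⪰ {N = N} {T = T} (sN , na , domN) sT ta le =
    ⪰-trans sN (MeetStable.meetStable sN sT)
            (domN _ (MeetStable.meetStable sN sT) (meetKeeps N T na ta le)) (meet⪰₂ N T)

  admissible⇒stable : ∀ L → Admissible L → AllStable L
  admissible⇒stable L (members , _) p = proj₁ (members p)

  -- Injectivity: if ⋁ L₁ ∼ ⋁ L₂, every member T ∼ M(a,b) of L₁ is ∼ a member
  -- of L₂.  Indeed M(a,b) ⪰ ⋁ L₂, so a's partner in ⋁ L₂, which he has in
  -- some T₂ ∈ L₂, is no better than b; thus M(a,b) ⪰ T₂, and L₂ is closed.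
  ⋁-reflects : ∀ L₁ L₂ → Admissible L₁ → Admissible L₂ → ⋁ L₁ ∼ ⋁ L₂
             → T ∈ toList L₁ → ∃[ T' ] (T' ∈ toList L₂ × T ∼ T')
  ⋁-reflects L₁ L₂ adm₁ adm₂ J₁∼J₂ p
    with proj₁ adm₁ p
  ... | sT , (a , b , N , sN , na , domN , N∼T) =
    let st₁ = admissible⇒stable L₁ adm₁
        st₂ = admissible⇒stable L₂ adm₂
        sJ₁ = ⋁-stable L₁ st₁
        N⪰J₂ = ⪰-trans sN sT (∼⇒⪰ N∼T) (⪰-trans sT sJ₁ (⋁-lower L₁ st₁ p) (∼⇒⪰ J₁∼J₂))
        (c , j₂a) = matchedIn sN (⋁-stable L₂ st₂) na
        (T₂ , p₂ , t₂a) = ⋁-partner L₂ j₂a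
        bestN = sN , na , domN
        (T'' , p'' , T''∼N) = proj₂ adm₂ p₂ N sN (best⇒irreducible bestN)
                                (best⪰ bestN (st₂ p₂) t₂a (N⪰J₂ a b c na j₂a))
    in T'' , p'' , ∼-trans sT sN (∼-sym N∼T) (∼-sym T''∼N)

  partners : List (Maybe (Fin n))
  partners = nothing ∷ map just (allFin n)

  partners-complete : ∀ u → u ∈ partners
  partners-complete nothing  = here refl
  partners-complete (just b) = there (∈-map⁺ just (∈-allFin b))

  open Enumeration partners partners-complete using (functions; functions-complete)

  matchings : List (Matching m n)
  matchings = functions m

  module Pointwise {P P' : Matching m n} (P≗P' : ∀ x → P x ≡ P' x) where
    back : P' x ≡ just b → P x ≡ just b
    back {x} e = trans (P≗P' x) e

    forth : P x ≡ just b → P' x ≡ just b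
    forth {x} e = trans (sym (P≗P' x)) e

    stable : StronglyStable P → StronglyStable P'
    stable sP = ((λ _ _ e → isEdge sP (back e)) , (λ _ _ _ e e' → womanInjective sP (back e) (back e')))
              , λ a b blocking → unblocked sP (blockTransfer blocking
                                   (sameMan {X = P} {J = P'} forth) (sameWoman {X = P} {J = P'} forth))

    dominated : X ⪰ P' → X ⪰ P
    dominated X⪰P' a b b' xa pa = X⪰P' a b b' xa (forth pa)

  _⪰?_ : ∀ X Y → Dec (X ⪰ Y)
  X ⪰? Y = Fin.all? λ a → Fin.all? λ b → Fin.all? λ b' →
             (X a ≟M just b) →-dec ((Y a ≟M just b') →-dec (rkA a b ≤? rkA a b'))

  stable? : ∀ X → Dec (StronglyStable X)
  stable? X = (edges? ×-dec injective?) ×-dec unblocked?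
    where
      partnerCondition : ∀ {R : ℕ → ℕ → Set} → (∀ i j → Dec (R i j)) → ∀ a b → Dec (∀ b' → X a ≡ just b' → R (rkA a b) (rkA a b'))
      partnerCondition R? a b = Fin.all? λ b' → (X a ≟M just b') →-dec R? (rkA a b) (rkA a b')
      herCondition : ∀ {R : ℕ → ℕ → Set} → (∀ i j → Dec (R i j)) → ∀ b a → Dec (∀ a' → X a' ≡ just b → R (rkB b a) (rkB b a'))
      herCondition R? b a = Fin.all? λ a' → (X a' ≟M just b) →-dec R? (rkB b a) (rkB b a')
      edges? : Dec (∀ a b → X a ≡ just b → Edge a b)
      edges? = Fin.all? λ a → Fin.all? λ b → (X a ≟M just b) →-dec (adj a b Bool.≟ true)
      injective? : Dec (∀ a a' b → X a ≡ just b → X a' ≡ just b → a ≡ a')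
      injective? = Fin.all? λ a → Fin.all? λ a' → Fin.all? λ b →
                     (X a ≟M just b) →-dec ((X a' ≟M just b) →-dec (a Fin.≟ a'))
      blocks? : ∀ a b → Dec (Blocks X a b)
      blocks? a b = (adj a b Bool.≟ true) ×-dec ¬? (X a ≟M just b) ×-dec
                    ((partnerCondition _<?_ a b ×-dec herCondition _≤?_ b a)
                     ⊎-dec (herCondition _<?_ b a ×-dec partnerCondition _≤?_ a b))
      unblocked? : Dec (∀ a b → ¬ Blocks X a b)
      unblocked? = Fin.all? λ a → Fin.all? λ b → ¬? (blocks? a b)

  copy : StronglyStable P → ∃[ g ] (g ∈ matchings × StronglyStable g × (∀ x → P x ≡ g x))
  copy {P} sP = let (g , g∈ , P≗g) = functions-complete m P in g , g∈ , Pointwise.stable P≗g sP , P≗g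

  BestAmong : Fin m → Fin n → List (Matching m n) → Set
  BestAmong a b Qs =
      (∀ {Q} → Q ∈ Qs → StronglyStable Q → Q a ≢ just b)
    ⊎ ∃[ T ] (StronglyStable T × T a ≡ just b
              × (∀ {Q} → Q ∈ Qs → StronglyStable Q → Q a ≡ just b → T ⪰ Q))

  -- The witness is the meet of the matchings found.
  bestAmong : ∀ a b Qs → BestAmong a b Qs
  bestAmong a b []       = inj₁ (λ ())
  bestAmong a b (Q ∷ Qs) with stable? Q ×-dec (Q a ≟M just b) | bestAmong a b Qs
  ... | no ¬q | inj₁ none =
    inj₁ λ { (here refl) sQ qa → ¬q (sQ , qa) ; (there p) → none p }
  ... | no ¬q | inj₂ (T , sT , ta , dom) =
    inj₂ (T , sT , ta , λ { (here refl) sQ qa → ⊥-elim (¬q (sQ , qa)) ; (there p) → dom p })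
  ... | yes (sQ , qa) | inj₁ none =
    inj₂ (Q , sQ , qa , λ { (here refl) _ _ → ⪰-refl ; (there p) sQ' qa' → ⊥-elim (none p sQ' qa') })
  ... | yes (sQ , qa) | inj₂ (T , sT , ta , dom) =
    inj₂ (T ∧ Q , sK , meetKeeps T Q ta qa ≤-refl ,
          λ { (here refl) _ _ → meet⪰₂ T Q ; (there p) sQ' qa' → ⪰-trans sK sT (meet⪰₁ T Q) (dom p sQ' qa') })
    where
      sK : StronglyStable (T ∧ Q)
      sK = MeetStable.meetStable sT sQ

  found : BestAmong a b matchings → List (Matching m n)
  found (inj₁ _)       = []
  found (inj₂ (T , _)) = T ∷ []

  found-best : (s : BestAmong a b matchings) → T ∈ found s → Best a b T
  found-best (inj₂ (T , sT , ta , dom)) (here refl) = sT , ta , λ N sN na →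
    let (g , g∈ , sg , N≗g) = copy sN
    in Pointwise.dominated N≗g (dom g∈ sg (Pointwise.forth N≗g na))

  found-complete : (s : BestAmong a b matchings) → StronglyStable P → P a ≡ just b
                 → ∃[ T ] (T ∈ found s × Best a b T)
  found-complete (inj₁ none) sP pa =
    let (g , g∈ , sg , P≗g) = copy sP in ⊥-elim (none g∈ sg (Pointwise.forth P≗g pa))
  found-complete s@(inj₂ (T , _)) _ _ = T , here refl , found-best s (here refl)

  irreducibles : List (Matching m n)
  irreducibles = concatMap (λ (a , b) → found (bestAmong a b matchings))
                           (cartesianProduct (allFin m) (allFin n))

  irreducibles-best : T ∈ irreducibles → ∃[ a ] ∃[ b ] Best a b T
  irreducibles-best T∈ with satisfied (∈-concatMap⁻ _ {xs = cartesianProduct (allFin m) (allFin n)} T∈)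
  ... | (a , b) , T∈found = a , b , found-best (bestAmong a b matchings) T∈found

  irreducibles-complete : StronglyStable P → P a ≡ just b → ∃[ T ] (T ∈ irreducibles × Best a b T)
  irreducibles-complete {a = a} {b} sP pa =
    let (T , T∈found , best) = found-complete (bestAmong a b matchings) sP pa
        ab∈ = ∈-cartesianProduct⁺ (∈-allFin a) (∈-allFin b)
    in T , ∈-concatMap⁺ _ (lose ab∈ T∈found) , best

  -- A strongly stable matching of a graph with an edge (a,b) matches some
  -- man, since otherwise (a,b) would block it.
  someMatched : Edge a b → StronglyStable M → ∃[ a₀ ] ∃[ b₀ ] M a₀ ≡ just b₀
  someMatched {a} {b} {M} edge sM with M a in ma
  ... | just b' = a , b' , ma
  ... | nothing with Fin.any? (λ c → M c ≟M just b)
  ...   | yes (c , mc) = c , b , mc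
  ...   | no unmatched = ⊥-elim (unblocked sM
            (edge , (λ e → nothing≢just (trans (sym ma) e)) ,
             inj₁ ((λ _ e → ⊥-elim (nothing≢just (trans (sym ma) e))) , (λ c mc → ⊥-elim (unmatched (c , mc))))))

  generators : Matching m n → List (Matching m n)
  generators M = filter (_⪰? M) irreducibles

  -- Surjectivity: M is the join of the list of its generators, headed by
  -- one of them, M(a₀,b₀) for a pair (a₀,b₀) of M.  This set is closed since
  -- a class dominating a generator dominates M; its join dominates M as every
  -- member does, and is dominated by M since each pair (a,b) of M yields the
  -- generator M(a,b).
  ⋁-onto : ∃[ a ] ∃[ b ] Edge a b → StronglyStable M → ∃[ L ] (Admissible L × ⋁ L ∼ M)
  ⋁-onto {M} (_ , _ , edge) sM with someMatched edge sM
  ... | _ , _ , ma₀ = L , (irreducibleL , closed) , ⪰-antisym (⋁-bound L (λ p → proj₂ (member p))) below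
    where
      generator : Best a b N → N ⪰ M → ∃[ T ] (T ∈ generators M × Best a b T × T ∼ N)
      generator bestN@(sN , na , _) N⪰M =
        let (T , T∈ , bestT) = irreducibles-complete sN na
            T∼N = best-unique bestT bestN
        in T , ∈-filter⁺ (_⪰? M) T∈ (⪰-trans (proj₁ bestT) sN (∼⇒⪰ T∼N) N⪰M) , bestT , T∼N

      representative : M a ≡ just b → ∃[ T ] (T ∈ generators M × Best a b T)
      representative ma =
        let (T , _ , best) = irreducibles-complete sM ma
            (T' , T'∈ , best' , _) = generator best (proj₂ (proj₂ best) M sM ma)
        in T' , T'∈ , best'

      L : List⁺ (Matching m n)
      L = proj₁ (representative ma₀) ∷⁺ generators M

      member : T ∈ toList L → (∃[ a ] ∃[ b ] Best a b T) × T ⪰ M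
      member (here refl) = member (there (proj₁ (proj₂ (representative ma₀))))
      member (there p)   = let (T∈ , T⪰M) = ∈-filter⁻ (_⪰? M) p in irreducibles-best T∈ , T⪰M

      stableL : AllStable L
      stableL p = let ((_ , _ , best) , _) = member p in proj₁ best

      irreducibleL : T ∈ toList L → StronglyStable T × Irreducible T
      irreducibleL p = let ((_ , _ , best) , _) = member p in proj₁ best , best⇒irreducible best

      closed : T ∈ toList L → ∀ T' → StronglyStable T' → Irreducible T' → T' ⪰ T
             → ∃[ T'' ] (T'' ∈ toList L × T'' ∼ T')
      closed p T' sT' (_ , _ , N , sN , na , domN , N∼T') T'⪰T =
        let N⪰M = ⪰-trans sN sT' (∼⇒⪰ N∼T') (⪰-trans sT' (stableL p) T'⪰T (proj₂ (member p)))
            (T'' , T''∈ , best'' , T''∼N) = generator (sN , na , domN) N⪰M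
        in T'' , there T''∈ , ∼-trans (proj₁ best'') sN T''∼N N∼T'

      below : M ⪰ ⋁ L
      below a b b' ma ja =
        let (T , T∈ , (_ , ta , _)) = representative ma
        in ⋁-lower L stableL (there T∈) a b b' ta ja

  ⋁-admissible : ∀ L → Admissible L → StronglyStable (⋁ L)
  ⋁-admissible L adm = ⋁-stable L (admissible⇒stable L adm)

  ⋁-respects : ∀ L₁ L₂ → Admissible L₁ → Admissible L₂ → SameClasses L₁ L₂ → ⋁ L₁ ∼ ⋁ L₂
  ⋁-respects L₁ L₂ adm₁ adm₂ (same₁ , same₂) =
    ⪰-antisym (⋁-mono L₁ L₂ (admissible⇒stable L₁ adm₁) (admissible⇒stable L₂ adm₂) same₁)
              (⋁-mono L₂ L₁ (admissible⇒stable L₂ adm₂) (admissible⇒stable L₁ adm₁) same₂)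

  ⋁-injective : ∀ L₁ L₂ → Admissible L₁ → Admissible L₂ → ⋁ L₁ ∼ ⋁ L₂ → SameClasses L₁ L₂
  ⋁-injective L₁ L₂ adm₁ adm₂ J₁∼J₂ =
    ⋁-reflects L₁ L₂ adm₁ adm₂ J₁∼J₂ , ⋁-reflects L₂ L₁ adm₂ adm₁ (∼-sym J₁∼J₂)

theorem5 : {m n : ℕ} (G : Instance m n)
    → ∃[ a ] ∃[ b ] Inst.Edge G a b
    → (∀ L → Inst.Admissible G L → Inst.StronglyStable G (Inst.⋁ G L))
      × (∀ L₁ L₂ → Inst.Admissible G L₁ → Inst.Admissible G L₂
           → Inst.SameClasses G L₁ L₂ → Inst._∼_ G (Inst.⋁ G L₁) (Inst.⋁ G L₂))
      × (∀ L₁ L₂ → Inst.Admissible G L₁ → Inst.Admissible G L₂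
           → Inst._∼_ G (Inst.⋁ G L₁) (Inst.⋁ G L₂) → Inst.SameClasses G L₁ L₂)
      × (∀ M → Inst.StronglyStable G M
           → ∃[ L ] (Inst.Admissible G L × Inst._∼_ G (Inst.⋁ G L) M))
theorem5 G edge = ⋁-admissible , ⋁-respects , ⋁-injective , (λ _ → ⋁-onto edge)
  where open Properties G
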